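{- Let $G$ be the digraph with $V(G)=\{u,v,w\}$ and $E(G)=\{(u,v),(u,w),(w,w)\}$. Then the associative spectrum of $\mathbb{A}(G)$ satisfies $s_n=|R_{n-1}|$ for all $n\ge3$. Hence $s_n=\Theta(\alpha^n)$, where $\alpha\approx1.755$ is the unique positive root of $x^4-x^3-x^2-1$.
   Context: The graph algebra $\mathbb{A}(G)$ of a digraph $G=(V,E)$ is the groupoid on $V\cup\{\infty\}$ ($\infty\notin V$) with $uv=u$ if $u,v\in V$ and $(u,v)\in E$, and $uv=\infty$ otherwise. The associative spectrum $s_n$ is the number of distinct $n$-ary term operations induced by all bracketings of $x_1x_2\cdots x_n$ (binary terms with $x_1,\dots,x_n$ each occurring once, in this order). For $m\ge2$, $R_m$ is the set of words of length $m$ over $\{0,1\}$ that do not start with $01$, do not end with $10$, and do not contain $101$. $\Theta(\alpha^n)$ means bounded between $c_1\alpha^n$ and $c_2\alpha^n$ for positive constants $c_1,c_2$. -}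

module Defs where

open import Data.Nat using (ℕ; zero; suc; _+_)
open import Data.Fin using (Fin; zero; suc)
open import Data.Bool using (Bool; true; false; _∧_; _∨_; not; if_then_else_)
open import Data.Maybe using (Maybe; just; nothing)
open import Data.List using (List; []; _∷_; length; filter; map; _++_)
open import Data.Vec using (Vec; []; _∷_; take; drop)
open import Data.Product using (_×_)
open import Data.Empty using (⊥)
open import Relation.Binary.PropositionalEquality using (_≡_)
open import Relation.Nullary using (¬_)
open import Relation.Nullary.Decidable using (does)
open import Data.Bool.Properties using (T?)
open import Data.List.Relation.Unary.All using (All)
open import Data.List.Relation.Unary.Any using (Any)
open import Data.List.Relation.Unary.AllPairs using (AllPairs)
open import Data.Rational using (ℚ; 1ℚ; _*_)

Digraph : ℕ → Set
Digraph k = Fin k → Fin k → Bool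

-- Carrier of the graph algebra: V ∪ {∞}, with ∞ represented by nothing.
GACarrier : ℕ → Set
GACarrier k = Maybe (Fin k)

gaMul : ∀ {k} → Digraph k → GACarrier k → GACarrier k → GACarrier k
gaMul E (just u) (just v) = if E u v then just u else nothing
gaMul E (just u) nothing  = nothing
gaMul E nothing  _        = nothing

data Bracketing : ℕ → Set where
  leaf : Bracketing 1
  node : ∀ {m l} → Bracketing m → Bracketing l → Bracketing (m + l)

termOp : ∀ {A : Set} → (A → A → A) → ∀ {n} → Bracketing n → Vec A n → A
termOp _·_ leaf (x ∷ []) = x
termOp _·_ (node {m} t s) xs = termOp _·_ t (take m xs) · termOp _·_ s (drop m xs)

SameOp : ∀ {A : Set} → (A → A → A) → ∀ {n} → Bracketing n → Bracketing n → Set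
SameOp {A} _·_ {n} t s = (xs : Vec A n) → termOp _·_ t xs ≡ termOp _·_ s xs

-- SpectrumIs _·_ n k : the number of distinct n-ary term operations
-- induced by bracketings of x₁⋯xₙ equals k, i.e. there is a list of k
-- bracketings inducing pairwise distinct operations such that every
-- bracketing induces the same operation as one of them.
SpectrumIs : ∀ {A : Set} → (A → A → A) → ℕ → ℕ → Set
SpectrumIs _·_ n k =
  Data.Product.Σ (List (Bracketing n)) λ ts →
    (length ts ≡ k)
    × AllPairs (λ t s → ¬ SameOp _·_ t s) ts
    × ((t : Bracketing n) → Any (SameOp _·_ t) ts)

-- The digraph G of the statement: V = {u,v,w} = {0,1,2},
-- E = {(u,v),(u,w),(w,w)}.

G : Digraph 3
G zero          (suc zero)          = true
G zero          (suc (suc zero))    = true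
G (suc (suc zero)) (suc (suc zero)) = true
G _ _ = false

𝔸G-mul : GACarrier 3 → GACarrier 3 → GACarrier 3
𝔸G-mul = gaMul G

-- R_m : words of length m over {0,1} (false = 0, true = 1)

allWords : ℕ → List (List Bool)
allWords zero    = [] ∷ []
allWords (suc m) = map (false ∷_) (allWords m) ++ map (true ∷_) (allWords m)

startsWith01 : List Bool → Bool
startsWith01 (false ∷ true ∷ _) = true
startsWith01 _ = false

endsWith10 : List Bool → Bool
endsWith10 (true ∷ false ∷ []) = true
endsWith10 (_ ∷ xs) = endsWith10 xs
endsWith10 [] = false

contains101 : List Bool → Bool
contains101 (true ∷ false ∷ true ∷ _) = true
contains101 (_ ∷ xs) = contains101 xs
contains101 [] = false

inR : List Bool → Bool
inR w = not (startsWith01 w) ∧ not (endsWith10 w) ∧ not (contains101 w)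

cardR : ℕ → ℕ
cardR m = length (filter (λ w → T? (inR w)) (allWords m))

infixr 8 _^ℚ_
_^ℚ_ : ℚ → ℕ → ℚ
q ^ℚ zero  = 1ℚ
q ^ℚ suc n = q * (q ^ℚ n)

polyP : ℚ → ℚ
polyP x = ((x ^ℚ 4 Data.Rational.- x ^ℚ 3) Data.Rational.- x ^ℚ 2) Data.Rational.- 1ℚ

{-# OPTIONS --safe #-}
module Submission where

-- In 𝔸(G) a product is its left factor or ∞, so a bracketing t of x₁⋯xₙ induces the operation
-- "x₁ if every later variable is admissible, ∞ otherwise", where admissibility is read off a word
-- of length n - 1, the signature of t: a leaf that is a right child on the leftmost branch
-- (letter 1) needs an edge from x₁, while the variables of a larger right subtree (letters 0)
-- must all be w, with an edge from x₁ to w, because x₁ · r = ∞ for every other value r such a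
-- subtree can take. Evaluating at u followed by the codes v, w of the letters of a signature
-- shows that two bracketings induce the same operation iff their signatures agree. The
-- signatures are the words all of whose maximal runs of 0s have length at least 2; for length
-- at least 2 these are the words of R, so sₙ = |R_{n-1}|. A four-state automaton recognises
-- them, and its transfer equations give fᵢ₊₄ = fᵢ₊₃ + fᵢ₊₂ + fᵢ for their numbers fᵢ. Comparing
-- f by induction with c qⁱ for q on either side of the root α of x⁴ - x³ - x² - 1 yields the
-- bounds.

open import Defs
open import Level using (0ℓ)
open import Data.Nat using (ℕ; zero; suc; _+_; _≤_; _∸_; s≤s)
import Data.Nat.Properties as ℕ
open import Data.Nat.Solver using () renaming (module +-*-Solver to ℕ-Solver)
import Data.Nat.Coprimality as Coprime
open import Data.Integer using (+_)
import Data.Integer as ℤ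
import Data.Integer.Properties as ℤ
open import Data.Rational using (ℚ; 0ℚ; _<_) renaming (_≤_ to _≤ℚ_; _*_ to _*ℚ_)
open import Data.Rational using (_/_)
open import Data.Rational using (1ℚ; mkℚ; -_; _≤?_; _<?_; nonNegative)
  renaming (_+_ to _+ℚ_; _-_ to _-ℚ_)
import Data.Rational.Properties as ℚ
open import Data.Rational.Solver using () renaming (module +-*-Solver to ℚ-Solver)
open import Data.Fin using (zero; suc)
open import Data.Fin.Properties using (injective⇒≤)
open import Data.Bool using (Bool; true; false; _∧_; if_then_else_)
open import Data.Bool.Properties using (T?; T-≡; ∧-assoc; ∧-identityʳ; ∧-zeroʳ)
open import Data.Maybe using (just; nothing)
open import Data.List using (List; []; _∷_; _++_; length; lookup; map; filter; replicate)
open import Data.List.Properties using (∷-injectiveʳ; length-++; filter-++; ++-assoc; ++-identityʳ)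
open import Data.List.Relation.Unary.All as All using ([])
open import Data.List.Relation.Unary.Any as Any using (Any; here)
import Data.List.Relation.Unary.Any.Properties as Any
open import Data.List.Relation.Unary.AllPairs as AllPairs using (AllPairs; []; _∷_)
import Data.List.Relation.Unary.AllPairs.Properties as AllPairs
open import Data.List.Membership.Propositional using (_∈_; mapWith∈)
open import Data.List.Membership.Propositional.Properties
  using (∈-lookup; ∈-map⁺; ∈-map⁻; ∈-++⁺ˡ; ∈-++⁺ʳ; ∈-++⁻; ∈-filter⁺; ∈-filter⁻;
         map-mapWith∈; mapWith∈-cong; mapWith∈-id)
import Data.List.Membership.Setoid as SetoidMembership
import Data.List.Membership.Setoid.Properties as SetoidMembershipₚ
open import Data.List.Relation.Unary.Unique.Propositional using (Unique)
import Data.List.Relation.Unary.Unique.Propositional.Properties as Unique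
import Data.List.Relation.Unary.Unique.Setoid as SetoidUnique
open import Data.Vec as Vec using (Vec; []; _∷_; take; drop; toList; fromList)
open import Data.Vec.Properties using (take++drop≡id; toList-++; length-toList; toList-map; toList∘fromList)
open import Data.Product using (_×_; Σ; ∃; _,_; -,_; proj₁; proj₂)
open import Data.Sum using (inj₁; inj₂)
open import Data.Empty using (⊥-elim)
open import Function using (_∘_)
open import Function.Bundles using (Equivalence)
open import Relation.Binary.Bundles using (Setoid)
open import Relation.Binary.PropositionalEquality
open import Relation.Nullary using (¬_; yes; no; contradiction)
open import Relation.Nullary.Decidable using (True; toWitness; from-yes)

toList-take-drop : ∀ {A : Set} m {l} (xs : Vec A (m + l)) →
                   toList xs ≡ toList (take m xs) ++ toList (drop m xs)
toList-take-drop m xs = trans (cong toList (sym (take++drop≡id m xs))) (toList-++ (take m xs) (drop m xs))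

toList-subst : ∀ {A : Set} {m n} (eq : m ≡ n) (xs : Vec A m) → toList (subst (Vec A) eq xs) ≡ toList xs
toList-subst refl xs = refl

replicate-suc-++ : ∀ {A : Set} n (x : A) xs → replicate (suc n) x ++ xs ≡ replicate n x ++ x ∷ xs
replicate-suc-++ zero x xs = refl
replicate-suc-++ (suc n) x xs = cong (x ∷_) (replicate-suc-++ n x xs)

length-filter-map : ∀ {A B : Set} (p : B → Bool) (f : A → B) xs →
                    length (filter (T? ∘ p) (map f xs)) ≡ length (filter (T? ∘ p ∘ f) xs)
length-filter-map p f [] = refl
length-filter-map p f (x ∷ xs) with p (f x)
... | true  = cong suc (length-filter-map p f xs)
... | false = length-filter-map p f xs

∧-distribʳ-∧ : ∀ a b c → (a ∧ b) ∧ c ≡ (a ∧ c) ∧ (b ∧ c)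
∧-distribʳ-∧ false b c = refl
∧-distribʳ-∧ true b true = refl
∧-distribʳ-∧ true true false = refl
∧-distribʳ-∧ true false false = refl

if-∧ : ∀ {A : Set} c d {x y : A} → (if c then (if d then x else y) else y) ≡ (if c ∧ d then x else y)
if-∧ true d = refl
if-∧ false d = refl

if≡then⇒true : ∀ {A : Set} c {x y : A} → x ≢ y → (if c then x else y) ≡ x → c ≡ true
if≡then⇒true true _ _ = refl
if≡then⇒true false x≢y y≡x = ⊥-elim (x≢y (sym y≡x))

module _ {c ℓ} (S : Setoid c ℓ) where
  open Setoid S using (_≈_) renaming (sym to ≈-sym)
  open SetoidMembership S using () renaming (_∈_ to _∈ₛ_)
  open SetoidUnique S using () renaming (Unique to Uniqueₛ)

  Unique⇒lookup-injective : ∀ {xs} → Uniqueₛ xs → ∀ i j → lookup xs i ≈ lookup xs j → i ≡ j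
  Unique⇒lookup-injective {_ ∷ _} _ zero zero _ = refl
  Unique⇒lookup-injective {_ ∷ _} (x≉xs ∷ _) zero (suc j) x≈ =
    contradiction x≈ (All.lookup x≉xs (∈-lookup j))
  Unique⇒lookup-injective {_ ∷ _} (x≉xs ∷ _) (suc i) zero ≈x =
    contradiction (≈-sym ≈x) (All.lookup x≉xs (∈-lookup i))
  Unique⇒lookup-injective {_ ∷ _} (_ ∷ xs!) (suc i) (suc j) eq =
    cong suc (Unique⇒lookup-injective xs! i j eq)

  Unique-⊆⇒length≤ : ∀ {xs ys} → Uniqueₛ xs → (∀ {x} → x ∈ₛ xs → x ∈ₛ ys) → length xs ≤ length ys
  Unique-⊆⇒length≤ {xs} xs! xs⊆ys = injective⇒≤ λ {i} {j} same-index →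
    Unique⇒lookup-injective xs! i j
      (SetoidMembershipₚ.index-injective S (xs⊆ys (SetoidMembershipₚ.∈-lookup S xs i))
                                           (xs⊆ys (SetoidMembershipₚ.∈-lookup S xs j)) same-index)

module _ {A : Set} (_·_ : A → A → A) where

  sameOp-setoid : ℕ → Setoid 0ℓ 0ℓ
  sameOp-setoid n = record
    { Carrier = Bracketing n
    ; _≈_ = SameOp _·_
    ; isEquivalence = record
      { refl = λ _ → refl
      ; sym = λ t≈s xs → sym (t≈s xs)
      ; trans = λ t≈s s≈r xs → trans (t≈s xs) (s≈r xs)
      }
    }

  spectrumIs-functional : ∀ {n k l} → SpectrumIs _·_ n k → SpectrumIs _·_ n l → k ≡ l
  spectrumIs-functional {n} (ts , refl , ts! , ts-cover) (ss , refl , ss! , ss-cover) =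
    ℕ.≤-antisym (Unique-⊆⇒length≤ (sameOp-setoid n) ts! (λ {t} _ → ss-cover t))
                (Unique-⊆⇒length≤ (sameOp-setoid n) ss! (λ {s} _ → ts-cover s))

  module _ {W : Set} {n} (inv : Bracketing n → W)
           (inv-sound : ∀ t s → inv t ≡ inv s → SameOp _·_ t s)
           (inv-complete : ∀ t s → SameOp _·_ t s → inv t ≡ inv s) where

    spectrumIs-length-image : (ws : List W) → Unique ws → (∀ t → inv t ∈ ws) →
                              (∀ {x} → x ∈ ws → Σ (Bracketing n) λ t → inv t ≡ x) →
                              SpectrumIs _·_ n (length ws)
    spectrumIs-length-image ws ws! inv∈ws realise =
      ts , SetoidMembershipₚ.length-mapWith∈ (setoid W) ws , distinct , cover
      where
      ts : List (Bracketing n)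
      ts = mapWith∈ ws (proj₁ ∘ realise)

      inv-ts : map inv ts ≡ ws
      inv-ts = trans (map-mapWith∈ ws (proj₁ ∘ realise) inv)
                     (trans (mapWith∈-cong ws _ _ (proj₂ ∘ realise)) (mapWith∈-id ws))

      distinct : AllPairs (λ t s → ¬ SameOp _·_ t s) ts
      distinct = AllPairs.map (λ inv≢ t≈s → inv≢ (inv-complete _ _ t≈s))
                              (AllPairs.map⁻ (subst Unique (sym inv-ts) ws!))

      cover : ∀ t → Any (SameOp _·_ t) ts
      cover t = Any.map (inv-sound t _) (Any.map⁻ (subst (inv t ∈_) (sym inv-ts) (inv∈ws t)))

-- Term operations of 𝔸(G)

A : Set
A = GACarrier 3

pattern ∞ = nothing
pattern u = just zero
pattern v = just (suc zero)
pattern w = just (suc (suc zero))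

infixl 7 _·_
_·_ : A → A → A
_·_ = 𝔸G-mul

edge : A → A → Bool
edge (just a) (just b) = G a b
edge _ _ = false

isW : A → Bool
isW w = true
isW _ = false

·-guard : ∀ x y → x · y ≡ (if edge x y then x else ∞)
·-guard ∞ y = refl
·-guard (just a) ∞ = refl
·-guard (just a) (just b) = refl

if-·ˡ : ∀ c {x} y → (if c then x else ∞) · y ≡ (if c then x · y else ∞)
if-·ˡ true y = refl
if-·ˡ false y = refl

isW-· : ∀ p q → isW (p · q) ≡ isW p ∧ isW q
isW-· ∞ q = refl
isW-· u ∞ = refl
isW-· u u = refl
isW-· u v = refl
isW-· u w = refl
isW-· v ∞ = refl
isW-· v (just b) = refl
isW-· w ∞ = refl
isW-· w u = refl
isW-· w v = refl
isW-· w w = refl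

·-≢v : ∀ p q → p · q ≢ v
·-≢v ∞ q ()
·-≢v (just a) ∞ ()
·-≢v u u ()
·-≢v u v ()
·-≢v u w ()
·-≢v v (just b) ()
·-≢v w u ()
·-≢v w v ()
·-≢v w w ()

-- No edge of G ends in u.
edge-≢v : ∀ x r → r ≢ v → edge x r ≡ isW r ∧ edge x w
edge-≢v x v r≢v = ⊥-elim (r≢v refl)
edge-≢v x w _ = refl
edge-≢v ∞ ∞ _ = refl
edge-≢v ∞ u _ = refl
edge-≢v u ∞ _ = refl
edge-≢v u u _ = refl
edge-≢v v ∞ _ = refl
edge-≢v v u _ = refl
edge-≢v w ∞ _ = refl
edge-≢v w u _ = refl

admissible : A → Bool → A → Bool
admissible x true  y = edge x y
admissible x false y = isW y ∧ edge x w

admits : A → List Bool → List A → Bool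
admits x (b ∷ σ) (y ∷ ys) = admissible x b y ∧ admits x σ ys
admits x _ _ = true

signatureOp : List Bool → List A → A
signatureOp σ [] = ∞
signatureOp σ (x ∷ ys) = if admits x σ ys then x else ∞

admits-++ : ∀ x σ τ ys zs → length σ ≡ length ys →
            admits x (σ ++ τ) (ys ++ zs) ≡ admits x σ ys ∧ admits x τ zs
admits-++ x [] τ [] zs _ = refl
admits-++ x (b ∷ σ) τ (y ∷ ys) zs eq =
  trans (cong (admissible x b y ∧_) (admits-++ x σ τ ys zs (ℕ.suc-injective eq)))
        (sym (∧-assoc (admissible x b y) _ _))

zeros : ∀ {n} → Bracketing n → List Bool
zeros leaf = false ∷ []
zeros (node t s) = zeros t ++ zeros s

rightBlock : ∀ {n} → Bracketing n → List Bool
rightBlock leaf = true ∷ []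
rightBlock s@(node _ _) = zeros s

signature : ∀ {n} → Bracketing n → List Bool
signature leaf = []
signature (node t s) = signature t ++ rightBlock s

length-zeros : ∀ {n} (t : Bracketing n) → length (zeros t) ≡ n
length-zeros leaf = refl
length-zeros (node t s) = trans (length-++ (zeros t)) (cong₂ _+_ (length-zeros t) (length-zeros s))

length-rightBlock : ∀ {n} (t : Bracketing n) → length (rightBlock t) ≡ n
length-rightBlock leaf = refl
length-rightBlock s@(node _ _) = length-zeros s

length-signature : ∀ {n} (t : Bracketing n) → suc (length (signature t)) ≡ n
length-signature leaf = refl
length-signature (node t s) =
  trans (cong suc (length-++ (signature t))) (cong₂ _+_ (length-signature t) (length-rightBlock s))

admits-zeros : ∀ x {l} (s : Bracketing l) (zs : Vec A l) →
               admits x (zeros s) (toList zs) ≡ isW (termOp _·_ s zs) ∧ edge x w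
admits-zeros x leaf (z ∷ []) = ∧-identityʳ _
admits-zeros x (node {m} a b) zs = begin
  admits x (zeros a ++ zeros b) (toList zs)
    ≡⟨ cong (admits x (zeros a ++ zeros b)) (toList-take-drop m zs) ⟩
  admits x (zeros a ++ zeros b) (toList za ++ toList zb)
    ≡⟨ admits-++ x (zeros a) (zeros b) _ _ (trans (length-zeros a) (sym (length-toList za))) ⟩
  admits x (zeros a) (toList za) ∧ admits x (zeros b) (toList zb)
    ≡⟨ cong₂ _∧_ (admits-zeros x a za) (admits-zeros x b zb) ⟩
  (isW ra ∧ edge x w) ∧ (isW rb ∧ edge x w)
    ≡⟨ ∧-distribʳ-∧ (isW ra) (isW rb) (edge x w) ⟨
  (isW ra ∧ isW rb) ∧ edge x w
    ≡⟨ cong (_∧ edge x w) (isW-· ra rb) ⟨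
  isW (ra · rb) ∧ edge x w ∎
  where
  open ≡-Reasoning
  za = take m zs
  zb = drop m zs
  ra = termOp _·_ a za
  rb = termOp _·_ b zb

·-termOp : ∀ x {l} (s : Bracketing l) (zs : Vec A l) →
           x · termOp _·_ s zs ≡ (if admits x (rightBlock s) (toList zs) then x else ∞)
·-termOp x leaf (z ∷ []) = trans (·-guard x z) (cong (if_then x else ∞) (sym (∧-identityʳ _)))
·-termOp x s@(node {m} a b) zs = begin
  x · r                                             ≡⟨ ·-guard x r ⟩
  (if edge x r then x else ∞)                       ≡⟨ cong (if_then x else ∞) (edge-≢v x r r≢v) ⟩
  (if isW r ∧ edge x w then x else ∞)               ≡⟨ cong (if_then x else ∞) (admits-zeros x s zs) ⟨
  (if admits x (zeros s) (toList zs) then x else ∞) ∎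
  where
  open ≡-Reasoning
  r = termOp _·_ s zs
  r≢v = ·-≢v (termOp _·_ a (take m zs)) (termOp _·_ b (drop m zs))

signatureOp-· : ∀ σ {m l} (ys : Vec A m) (s : Bracketing l) (zs : Vec A l) → suc (length σ) ≡ m →
                signatureOp σ (toList ys) · termOp _·_ s zs
                  ≡ signatureOp (σ ++ rightBlock s) (toList ys ++ toList zs)
signatureOp-· σ (y ∷ ys) s zs eq = begin
  (if admits y σ (toList ys) then y else ∞) · termOp _·_ s zs
    ≡⟨ if-·ˡ (admits y σ (toList ys)) _ ⟩
  (if admits y σ (toList ys) then y · termOp _·_ s zs else ∞)
    ≡⟨ cong (if admits y σ (toList ys) then_else ∞) (·-termOp y s zs) ⟩
  (if admits y σ (toList ys) then (if admits y (rightBlock s) (toList zs) then y else ∞) else ∞)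
    ≡⟨ if-∧ (admits y σ (toList ys)) _ ⟩
  (if admits y σ (toList ys) ∧ admits y (rightBlock s) (toList zs) then y else ∞)
    ≡⟨ cong (if_then y else ∞) (admits-++ y σ _ _ _ (trans (ℕ.suc-injective eq) (sym (length-toList ys)))) ⟨
  (if admits y (σ ++ rightBlock s) (toList ys ++ toList zs) then y else ∞) ∎
  where open ≡-Reasoning

termOp-signature : ∀ {n} (t : Bracketing n) (xs : Vec A n) →
                   termOp _·_ t xs ≡ signatureOp (signature t) (toList xs)
termOp-signature leaf (x ∷ []) = refl
termOp-signature (node {m} t s) xs = begin
  termOp _·_ t (take m xs) · termOp _·_ s (drop m xs)
    ≡⟨ cong (_· termOp _·_ s (drop m xs)) (termOp-signature t (take m xs)) ⟩
  signatureOp (signature t) (toList (take m xs)) · termOp _·_ s (drop m xs)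
    ≡⟨ signatureOp-· (signature t) (take m xs) s (drop m xs) (length-signature t) ⟩
  signatureOp (signature t ++ rightBlock s) (toList (take m xs) ++ toList (drop m xs))
    ≡⟨ cong (signatureOp _) (toList-take-drop m xs) ⟨
  signatureOp (signature (node t s)) (toList xs) ∎
  where open ≡-Reasoning

encode : Bool → A
encode true  = v
encode false = w

admits-encode-self : ∀ σ → admits u σ (map encode σ) ≡ true
admits-encode-self [] = refl
admits-encode-self (true ∷ σ) = admits-encode-self σ
admits-encode-self (false ∷ σ) = admits-encode-self σ

-- At a letter 0, u admits only w, the code of 0.
admits-encode-antisym : ∀ σ τ → length σ ≡ length τ →
                        admits u σ (map encode τ) ≡ true → admits u τ (map encode σ) ≡ true → σ ≡ τ
admits-encode-antisym [] [] _ _ _ = refl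
admits-encode-antisym (true ∷ σ) (true ∷ τ) eq p q =
  cong (true ∷_) (admits-encode-antisym σ τ (ℕ.suc-injective eq) p q)
admits-encode-antisym (false ∷ σ) (false ∷ τ) eq p q =
  cong (false ∷_) (admits-encode-antisym σ τ (ℕ.suc-injective eq) p q)
admits-encode-antisym (true ∷ σ) (false ∷ τ) _ _ ()
admits-encode-antisym (false ∷ σ) (true ∷ τ) _ ()

probe : ∀ {n} → Bracketing n → Vec A n
probe t = subst (Vec A) (length-signature t) (u ∷ Vec.map encode (fromList (signature t)))

toList-probe : ∀ {n} (t : Bracketing n) → toList (probe t) ≡ u ∷ map encode (signature t)
toList-probe t = begin
  toList (probe t)                                      ≡⟨ toList-subst (length-signature t) _ ⟩
  u ∷ toList (Vec.map encode (fromList (signature t)))  ≡⟨ cong (u ∷_) (toList-map encode _) ⟩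
  u ∷ map encode (toList (fromList (signature t)))      ≡⟨ cong ((u ∷_) ∘ map encode) (toList∘fromList _) ⟩
  u ∷ map encode (signature t)                          ∎
  where open ≡-Reasoning

termOp-probe : ∀ {n} (t r : Bracketing n) →
               termOp _·_ r (probe t) ≡ (if admits u (signature r) (map encode (signature t)) then u else ∞)
termOp-probe t r = trans (termOp-signature r (probe t)) (cong (signatureOp (signature r)) (toList-probe t))

signature≡⇒sameOp : ∀ {n} (t s : Bracketing n) → signature t ≡ signature s → SameOp _·_ t s
signature≡⇒sameOp t s eq xs = begin
  termOp _·_ t xs                          ≡⟨ termOp-signature t xs ⟩
  signatureOp (signature t) (toList xs)    ≡⟨ cong (λ σ → signatureOp σ (toList xs)) eq ⟩
  signatureOp (signature s) (toList xs)    ≡⟨ termOp-signature s xs ⟨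
  termOp _·_ s xs                          ∎
  where open ≡-Reasoning

sameOp⇒signature≡ : ∀ {n} (t s : Bracketing n) → SameOp _·_ t s → signature t ≡ signature s
sameOp⇒signature≡ t s t≈s =
  admits-encode-antisym (signature t) (signature s)
    (ℕ.suc-injective (trans (length-signature t) (sym (length-signature s))))
    (admitted-at-probe s t (sym (t≈s (probe s))))
    (admitted-at-probe t s (t≈s (probe t)))
  where
  admitted-at-probe : ∀ {n} (t r : Bracketing n) → termOp _·_ t (probe t) ≡ termOp _·_ r (probe t) →
                      admits u (signature r) (map encode (signature t)) ≡ true
  admitted-at-probe t r same = if≡then⇒true _ (λ ()) (begin
    (if admits u (signature r) (map encode (signature t)) then u else ∞) ≡⟨ termOp-probe t r ⟨
    termOp _·_ r (probe t)                                               ≡⟨ same ⟨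
    termOp _·_ t (probe t)                                               ≡⟨ termOp-probe t t ⟩
    (if admits u (signature t) (map encode (signature t)) then u else ∞)
      ≡⟨ cong (if_then u else ∞) (admits-encode-self (signature t)) ⟩
    u                                                                    ∎)
    where open ≡-Reasoning

-- Signatures are the words of R

-- accepts boundary σ holds iff every maximal run of 0s in σ has length at least 2.
data State : Set where
  boundary oneZero manyZeros dead : State

step : State → Bool → State
step boundary  true  = boundary
step boundary  false = oneZero
step oneZero   true  = dead
step oneZero   false = manyZeros
step manyZeros true  = boundary
step manyZeros false = manyZeros
step dead      _     = dead

accepting : State → Bool
accepting boundary  = true
accepting manyZeros = true
accepting _         = false

run : State → List Bool → State
run q [] = q
run q (b ∷ σ) = run (step q b) σ

accepts : State → List Bool → Bool
accepts q σ = accepting (run q σ)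

run-++ : ∀ q σ τ → run q (σ ++ τ) ≡ run (run q σ) τ
run-++ q [] τ = refl
run-++ q (b ∷ σ) τ = run-++ (step q b) σ τ

accepts-dead : ∀ σ → accepts dead σ ≡ false
accepts-dead [] = refl
accepts-dead (b ∷ σ) = accepts-dead σ

mutual
  accepts-boundary : ∀ σ → accepts boundary σ ≡ inR (true ∷ σ)
  accepts-boundary [] = refl
  accepts-boundary (true ∷ σ) = accepts-boundary σ
  accepts-boundary (false ∷ σ) = accepts-oneZero σ

  accepts-oneZero : ∀ σ → accepts oneZero σ ≡ inR (true ∷ false ∷ σ)
  accepts-oneZero [] = refl
  accepts-oneZero (true ∷ σ) = trans (accepts-dead σ) (sym (∧-zeroʳ _))
  accepts-oneZero (false ∷ σ) = accepts-manyZeros σ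

  accepts-manyZeros : ∀ σ → accepts manyZeros σ ≡ inR (false ∷ false ∷ σ)
  accepts-manyZeros [] = refl
  accepts-manyZeros (true ∷ σ) = accepts-boundary σ
  accepts-manyZeros (false ∷ σ) = accepts-manyZeros σ

inR≡accepts : ∀ {k} σ → length σ ≡ suc (suc k) → inR σ ≡ accepts boundary σ
inR≡accepts (true ∷ b ∷ σ) _ = sym (accepts-boundary (b ∷ σ))
inR≡accepts (false ∷ true ∷ σ) _ = sym (accepts-dead σ)
inR≡accepts (false ∷ false ∷ σ) _ = sym (accepts-manyZeros σ)

data Settled : State → Set where
  boundary  : Settled boundary
  manyZeros : Settled manyZeros

data Pending : State → Set where
  oneZero   : Pending oneZero
  manyZeros : Pending manyZeros

run-zeros-pending : ∀ {q n} → Pending q → (t : Bracketing n) → run q (zeros t) ≡ manyZeros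
run-zeros-pending oneZero leaf = refl
run-zeros-pending manyZeros leaf = refl
run-zeros-pending {q} p (node t s) = begin
  run q (zeros t ++ zeros s)        ≡⟨ run-++ q (zeros t) (zeros s) ⟩
  run (run q (zeros t)) (zeros s)   ≡⟨ cong (λ r → run r (zeros s)) (run-zeros-pending p t) ⟩
  run manyZeros (zeros s)           ≡⟨ run-zeros-pending manyZeros s ⟩
  manyZeros                         ∎
  where open ≡-Reasoning

run-zeros-settled : ∀ {q n} → Settled q → (t : Bracketing n) → Pending (run q (zeros t))
run-zeros-settled boundary leaf = oneZero
run-zeros-settled manyZeros leaf = manyZeros
run-zeros-settled {q} p (node t s)
  rewrite run-++ q (zeros t) (zeros s) | run-zeros-pending (run-zeros-settled p t) s = manyZeros

run-rightBlock : ∀ {q n} → Settled q → (s : Bracketing n) → Settled (run q (rightBlock s))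
run-rightBlock boundary leaf = boundary
run-rightBlock manyZeros leaf = boundary
run-rightBlock {q} p (node t s)
  rewrite run-++ q (zeros t) (zeros s) | run-zeros-pending (run-zeros-settled p t) s = manyZeros

run-signature : ∀ {n} (t : Bracketing n) → Settled (run boundary (signature t))
run-signature leaf = boundary
run-signature (node t s) rewrite run-++ boundary (signature t) (rightBlock s) =
  run-rightBlock (run-signature t) s

accepts-signature : ∀ {n} (t : Bracketing n) → accepts boundary (signature t) ≡ true
accepts-signature t with run boundary (signature t) | run-signature t
... | .boundary  | boundary  = refl
... | .manyZeros | manyZeros = refl

zeroBlock : (k : ℕ) → Bracketing (2 + k)
zeroBlock zero = node leaf leaf
zeroBlock (suc k) = node leaf (zeroBlock k)

zeros-zeroBlock : ∀ k → zeros (zeroBlock k) ≡ replicate (2 + k) false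
zeros-zeroBlock zero = refl
zeros-zeroBlock (suc k) = cong (false ∷_) (zeros-zeroBlock k)

rightBlock-zeroBlock : ∀ k → rightBlock (zeroBlock k) ≡ replicate (2 + k) false
rightBlock-zeroBlock zero = refl
rightBlock-zeroBlock (suc k) = zeros-zeroBlock (suc k)

mutual
  extend : ∀ {m} → Bracketing m → List Bool → ∃ Bracketing
  extend t [] = -, t
  extend t (true ∷ σ) = extend (node t leaf) σ
  extend t (false ∷ false ∷ σ) = extendZeroRun t 0 σ
  -- an isolated 0 occurs in no signature; the value is irrelevant
  extend t (false ∷ _) = -, t

  extendZeroRun : ∀ {m} → Bracketing m → ℕ → List Bool → ∃ Bracketing
  extendZeroRun t k [] = -, node t (zeroBlock k)
  extendZeroRun t k (false ∷ σ) = extendZeroRun t (suc k) σ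
  extendZeroRun t k (true ∷ σ) = extend (node (node t (zeroBlock k)) leaf) σ

mutual
  signature-extend : ∀ {m} (t : Bracketing m) σ → accepts boundary σ ≡ true →
                     signature (proj₂ (extend t σ)) ≡ signature t ++ σ
  signature-extend t [] _ = sym (++-identityʳ _)
  signature-extend t (true ∷ σ) acc =
    trans (signature-extend (node t leaf) σ acc) (++-assoc (signature t) _ σ)
  signature-extend t (false ∷ false ∷ σ) acc = signature-extendZeroRun t 0 σ acc
  signature-extend t (false ∷ true ∷ σ) acc with () ← trans (sym (accepts-dead σ)) acc

  signature-extendZeroRun : ∀ {m} (t : Bracketing m) k σ → accepts manyZeros σ ≡ true →
                            signature (proj₂ (extendZeroRun t k σ))
                              ≡ signature t ++ replicate (2 + k) false ++ σ
  signature-extendZeroRun t k [] _ = begin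
    signature t ++ rightBlock (zeroBlock k)       ≡⟨ cong (signature t ++_) (rightBlock-zeroBlock k) ⟩
    signature t ++ replicate (2 + k) false        ≡⟨ cong (signature t ++_) (++-identityʳ _) ⟨
    signature t ++ replicate (2 + k) false ++ []  ∎
    where open ≡-Reasoning
  signature-extendZeroRun t k (false ∷ σ) acc =
    trans (signature-extendZeroRun t (suc k) σ acc)
          (cong (signature t ++_) (replicate-suc-++ (2 + k) false σ))
  signature-extendZeroRun t k (true ∷ σ) acc = begin
    signature (proj₂ (extend (node (node t (zeroBlock k)) leaf) σ))
      ≡⟨ signature-extend (node (node t (zeroBlock k)) leaf) σ acc ⟩
    ((signature t ++ rightBlock (zeroBlock k)) ++ true ∷ []) ++ σ
      ≡⟨ cong (λ τ → ((signature t ++ τ) ++ true ∷ []) ++ σ) (rightBlock-zeroBlock k) ⟩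
    ((signature t ++ zs) ++ true ∷ []) ++ σ
      ≡⟨ ++-assoc (signature t ++ zs) _ σ ⟩
    (signature t ++ zs) ++ true ∷ σ
      ≡⟨ ++-assoc (signature t) zs _ ⟩
    signature t ++ zs ++ true ∷ σ ∎
    where
    open ≡-Reasoning
    zs = replicate (2 + k) false

signature-subst : ∀ {m n} (eq : m ≡ n) (t : Bracketing m) → signature (subst Bracketing eq t) ≡ signature t
signature-subst refl t = refl

fromSignature : ∀ {n} σ → suc (length σ) ≡ n → accepts boundary σ ≡ true →
                Σ (Bracketing n) λ t → signature t ≡ σ
fromSignature σ len acc with extend leaf σ | signature-extend leaf σ acc
... | m , t | refl = subst Bracketing size t , signature-subst size t
  where size = trans (sym (length-signature t)) len

allWords-length : ∀ m {σ} → σ ∈ allWords m → length σ ≡ m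
allWords-length zero (here refl) = refl
allWords-length (suc m) σ∈ with ∈-++⁻ (map (false ∷_) (allWords m)) σ∈
... | inj₁ σ∈₀ with _ , τ∈ , refl ← ∈-map⁻ (false ∷_) σ∈₀ = cong suc (allWords-length m τ∈)
... | inj₂ σ∈₁ with _ , τ∈ , refl ← ∈-map⁻ (true ∷_) σ∈₁ = cong suc (allWords-length m τ∈)

∈-allWords : ∀ σ → σ ∈ allWords (length σ)
∈-allWords [] = here refl
∈-allWords (false ∷ σ) = ∈-++⁺ˡ (∈-map⁺ (false ∷_) (∈-allWords σ))
∈-allWords (true ∷ σ) = ∈-++⁺ʳ (map (false ∷_) (allWords (length σ))) (∈-map⁺ (true ∷_) (∈-allWords σ))

allWords-unique : ∀ m → Unique (allWords m)
allWords-unique zero = [] ∷ []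
allWords-unique (suc m) =
  Unique.++⁺ (Unique.map⁺ ∷-injectiveʳ (allWords-unique m))
             (Unique.map⁺ ∷-injectiveʳ (allWords-unique m)) disjoint
  where
  disjoint : ∀ {σ} → ¬ (σ ∈ map (false ∷_) (allWords m) × σ ∈ map (true ∷_) (allWords m))
  disjoint (σ∈₀ , σ∈₁) with _ , _ , refl ← ∈-map⁻ (false ∷_) σ∈₀ | _ , _ , () ← ∈-map⁻ (true ∷_) σ∈₁

R : ℕ → List (List Bool)
R m = filter (T? ∘ inR) (allWords m)

∈-R⁻ : ∀ {m σ} → σ ∈ R m → length σ ≡ m × inR σ ≡ true
∈-R⁻ {m} σ∈ with σ∈all , inRσ ← ∈-filter⁻ (T? ∘ inR) {xs = allWords m} σ∈ =
  allWords-length m σ∈all , Equivalence.to T-≡ inRσ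

∈-R⁺ : ∀ {m σ} → length σ ≡ m → inR σ ≡ true → σ ∈ R m
∈-R⁺ {σ = σ} refl inRσ = ∈-filter⁺ (T? ∘ inR) (∈-allWords σ) (Equivalence.from T-≡ inRσ)

spectrumIs-cardR : ∀ k → SpectrumIs 𝔸G-mul (3 + k) (cardR (2 + k))
spectrumIs-cardR k =
  spectrumIs-length-image _·_ signature signature≡⇒sameOp sameOp⇒signature≡
    (R (2 + k)) (Unique.filter⁺ (T? ∘ inR) (allWords-unique (2 + k))) signature∈R realise
  where
  signature∈R : ∀ (t : Bracketing (3 + k)) → signature t ∈ R (2 + k)
  signature∈R t = ∈-R⁺ len (trans (inR≡accepts (signature t) len) (accepts-signature t))
    where len = ℕ.suc-injective (length-signature t)

  realise : ∀ {σ} → σ ∈ R (2 + k) → Σ (Bracketing (3 + k)) λ t → signature t ≡ σ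
  realise {σ} σ∈ with len , inRσ ← ∈-R⁻ σ∈ =
    fromSignature σ (cong suc len) (trans (sym (inR≡accepts σ len)) inRσ)

countWords : (List Bool → Bool) → ℕ → ℕ
countWords p m = length (filter (T? ∘ p) (allWords m))

countWords-suc : ∀ p m → countWords p (suc m) ≡ countWords (p ∘ (false ∷_)) m + countWords (p ∘ (true ∷_)) m
countWords-suc p m = begin
  length (filter (T? ∘ p) (ws₀ ++ ws₁))                      ≡⟨ cong length (filter-++ (T? ∘ p) ws₀ ws₁) ⟩
  length (filter (T? ∘ p) ws₀ ++ filter (T? ∘ p) ws₁)        ≡⟨ length-++ (filter (T? ∘ p) ws₀) ⟩
  length (filter (T? ∘ p) ws₀) + length (filter (T? ∘ p) ws₁)
    ≡⟨ cong₂ _+_ (length-filter-map p (false ∷_) (allWords m))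
                 (length-filter-map p (true ∷_) (allWords m)) ⟩
  countWords (p ∘ (false ∷_)) m + countWords (p ∘ (true ∷_)) m ∎
  where
  open ≡-Reasoning
  ws₀ = map (false ∷_) (allWords m)
  ws₁ = map (true ∷_) (allWords m)

countWords-cong : ∀ {p q} m → (∀ σ → length σ ≡ m → p σ ≡ q σ) → countWords p m ≡ countWords q m
countWords-cong {p} {q} zero p≗q with p [] | q [] | p≗q [] refl
... | true  | .true  | refl = refl
... | false | .false | refl = refl
countWords-cong {p} {q} (suc m) p≗q = begin
  countWords p (suc m)                                              ≡⟨ countWords-suc p m ⟩
  countWords (p ∘ (false ∷_)) m + countWords (p ∘ (true ∷_)) m
    ≡⟨ cong₂ _+_ (countWords-cong m λ σ len → p≗q (false ∷ σ) (cong suc len))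
                 (countWords-cong m λ σ len → p≗q (true ∷ σ) (cong suc len)) ⟩
  countWords (q ∘ (false ∷_)) m + countWords (q ∘ (true ∷_)) m    ≡⟨ countWords-suc q m ⟨
  countWords q (suc m)                                              ∎
  where open ≡-Reasoning

accepted : State → ℕ → ℕ
accepted q = countWords (accepts q)

accepted-suc : ∀ q m → accepted q (suc m) ≡ accepted (step q false) m + accepted (step q true) m
accepted-suc q = countWords-suc (accepts q)

accepted-dead : ∀ m → accepted dead m ≡ 0
accepted-dead zero = refl
accepted-dead (suc m) = trans (accepted-suc dead m) (cong₂ _+_ (accepted-dead m) (accepted-dead m))

accepted-oneZero-suc : ∀ m → accepted oneZero (suc m) ≡ accepted manyZeros m
accepted-oneZero-suc m =
  trans (accepted-suc oneZero m)
        (trans (cong (_+_ (accepted manyZeros m)) (accepted-dead m)) (ℕ.+-identityʳ _))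

cardR≡accepted : ∀ k → cardR (2 + k) ≡ accepted boundary (2 + k)
cardR≡accepted k = countWords-cong (2 + k) inR≡accepts

accepted-boundary-rec : ∀ i → accepted boundary (4 + i)
                              ≡ accepted boundary (3 + i) + accepted boundary (2 + i) + accepted boundary i
accepted-boundary-rec i = begin
  b (4 + i)                                    ≡⟨ accepted-suc boundary (3 + i) ⟩
  z₁ (3 + i) + b (3 + i)                       ≡⟨ cong (_+ b (3 + i)) (accepted-oneZero-suc (2 + i)) ⟩
  z (2 + i) + b (3 + i)                        ≡⟨ cong (_+ b (3 + i)) (accepted-suc manyZeros (1 + i)) ⟩
  (z (1 + i) + b (1 + i)) + b (3 + i)
    ≡⟨ cong (λ r → (r + b (1 + i)) + b (3 + i)) (accepted-suc manyZeros i) ⟩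
  ((z i + b i) + b (1 + i)) + b (3 + i)
    ≡⟨ solve 4 (λ Z B B₁ B₃ → ((Z :+ B) :+ B₁) :+ B₃ := (B₃ :+ (Z :+ B₁)) :+ B) refl
               (z i) (b i) (b (1 + i)) (b (3 + i)) ⟩
  b (3 + i) + (z i + b (1 + i)) + b i
    ≡⟨ cong (λ r → b (3 + i) + (r + b (1 + i)) + b i) (accepted-oneZero-suc i) ⟨
  b (3 + i) + (z₁ (1 + i) + b (1 + i)) + b i
    ≡⟨ cong (λ r → b (3 + i) + r + b i) (accepted-suc boundary (1 + i)) ⟨
  b (3 + i) + b (2 + i) + b i                  ∎
  where
  open ≡-Reasoning
  open ℕ-Solver
  b z₁ z : ℕ → ℕ
  b = accepted boundary
  z₁ = accepted oneZero
  z = accepted manyZeros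

-- Growth

SubRecurrent SuperRecurrent : (ℕ → ℚ) → Set
SubRecurrent x = ∀ i → x (4 + i) ≤ℚ x (3 + i) +ℚ x (2 + i) +ℚ x i
SuperRecurrent x = ∀ i → x (3 + i) +ℚ x (2 + i) +ℚ x i ≤ℚ x (4 + i)

SubRecurrent-shift : ∀ {x} → SubRecurrent x → SubRecurrent (λ i → x (suc i))
SubRecurrent-shift sub i = sub (suc i)

SuperRecurrent-shift : ∀ {x} → SuperRecurrent x → SuperRecurrent (λ i → x (suc i))
SuperRecurrent-shift super i = super (suc i)

recurrence-comparison : ∀ {x y} → SubRecurrent x → SuperRecurrent y →
                        x 0 ≤ℚ y 0 → x 1 ≤ℚ y 1 → x 2 ≤ℚ y 2 → x 3 ≤ℚ y 3 → ∀ i → x i ≤ℚ y i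
recurrence-comparison {x} {y} sub super p₀ p₁ p₂ p₃ i = proj₁ (window i)
  where
  window : ∀ i → x i ≤ℚ y i × x (1 + i) ≤ℚ y (1 + i) × x (2 + i) ≤ℚ y (2 + i) × x (3 + i) ≤ℚ y (3 + i)
  window zero = p₀ , p₁ , p₂ , p₃
  window (suc i) with q₀ , q₁ , q₂ , q₃ ← window i = q₁ , q₂ , q₃ , (begin
    x (4 + i)                          ≤⟨ sub i ⟩
    x (3 + i) +ℚ x (2 + i) +ℚ x i      ≤⟨ ℚ.+-mono-≤ (ℚ.+-mono-≤ q₃ q₂) q₀ ⟩
    y (3 + i) +ℚ y (2 + i) +ℚ y i      ≤⟨ super i ⟩
    y (4 + i)                          ∎)
    where open ℚ.≤-Reasoning

0≤1ℚ : 0ℚ ≤ℚ 1ℚ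
0≤1ℚ = from-yes (0ℚ ≤? 1ℚ)

nonNeg-* : ∀ {p q} → 0ℚ ≤ℚ p → 0ℚ ≤ℚ q → 0ℚ ≤ℚ p *ℚ q
nonNeg-* {p} {q} 0≤p 0≤q =
  ℚ.nonNegative⁻¹ _ {{ℚ.nonNeg*nonNeg⇒nonNeg p {{nonNegative 0≤p}} q {{nonNegative 0≤q}}}}

p≤q⇒0≤q-p : ∀ {p q} → p ≤ℚ q → 0ℚ ≤ℚ q -ℚ p
p≤q⇒0≤q-p {p} p≤q = ℚ.≤-trans (ℚ.≤-reflexive (sym (ℚ.+-inverseʳ p))) (ℚ.+-monoˡ-≤ (- p) p≤q)

^-nonNeg : ∀ {q} k → 0ℚ ≤ℚ q → 0ℚ ≤ℚ q ^ℚ k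
^-nonNeg zero _ = 0≤1ℚ
^-nonNeg (suc k) 0≤q = nonNeg-* 0≤q (^-nonNeg k 0≤q)

^-monoˡ-≤ : ∀ {p q} k → 0ℚ ≤ℚ p → p ≤ℚ q → p ^ℚ k ≤ℚ q ^ℚ k
^-monoˡ-≤ zero _ _ = ℚ.≤-refl
^-monoˡ-≤ {p} {q} (suc k) 0≤p p≤q = begin
  p *ℚ p ^ℚ k   ≤⟨ ℚ.*-monoˡ-≤-nonNeg p {{nonNegative 0≤p}} (^-monoˡ-≤ k 0≤p p≤q) ⟩
  p *ℚ q ^ℚ k   ≤⟨ ℚ.*-monoʳ-≤-nonNeg (q ^ℚ k) {{nonNegative (^-nonNeg k (ℚ.≤-trans 0≤p p≤q))}} p≤q ⟩
  q *ℚ q ^ℚ k   ∎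
  where open ℚ.≤-Reasoning

1≤^ : ∀ {q} k → 1ℚ ≤ℚ q → 1ℚ ≤ℚ q ^ℚ k
1≤^ {q} k 1≤q = subst (_≤ℚ q ^ℚ k) (1^ k) (^-monoˡ-≤ k 0≤1ℚ 1≤q)
  where
  1^ : ∀ k → 1ℚ ^ℚ k ≡ 1ℚ
  1^ zero = refl
  1^ (suc k) = trans (ℚ.*-identityˡ _) (1^ k)

module _ (c q : ℚ) where
  open ℚ-Solver

  private
    geometric-split : ∀ i → c *ℚ q ^ℚ (4 + i) ≡ (c *ℚ q ^ℚ i) *ℚ q ^ℚ 4
    geometric-split i =
      solve 3 (λ c q X → c :* (q :* (q :* (q :* (q :* X)))) := (c :* X) :* q :^ 4) refl c q (q ^ℚ i)

    geometric-sum : ∀ i → c *ℚ q ^ℚ (3 + i) +ℚ c *ℚ q ^ℚ (2 + i) +ℚ c *ℚ q ^ℚ i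
                          ≡ (c *ℚ q ^ℚ i) *ℚ (q ^ℚ 3 +ℚ q ^ℚ 2 +ℚ 1ℚ)
    geometric-sum i =
      solve 3 (λ c q X → c :* (q :* (q :* (q :* X))) :+ c :* (q :* (q :* X)) :+ c :* X
                         := (c :* X) :* (q :^ 3 :+ q :^ 2 :+ con 1ℚ)) refl c q (q ^ℚ i)

  geometric-subRecurrent : 0ℚ ≤ℚ c → 0ℚ ≤ℚ q → q ^ℚ 4 ≤ℚ q ^ℚ 3 +ℚ q ^ℚ 2 +ℚ 1ℚ →
                           SubRecurrent (λ i → c *ℚ q ^ℚ i)
  geometric-subRecurrent 0≤c 0≤q q⁴≤ i = begin
    c *ℚ q ^ℚ (4 + i)                                   ≡⟨ geometric-split i ⟩
    (c *ℚ q ^ℚ i) *ℚ q ^ℚ 4                             ≤⟨ ℚ.*-monoˡ-≤-nonNeg (c *ℚ q ^ℚ i) {{0≤cqⁱ}} q⁴≤ ⟩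
    (c *ℚ q ^ℚ i) *ℚ (q ^ℚ 3 +ℚ q ^ℚ 2 +ℚ 1ℚ)           ≡⟨ geometric-sum i ⟨
    c *ℚ q ^ℚ (3 + i) +ℚ c *ℚ q ^ℚ (2 + i) +ℚ c *ℚ q ^ℚ i ∎
    where
    open ℚ.≤-Reasoning
    0≤cqⁱ = nonNegative (nonNeg-* 0≤c (^-nonNeg i 0≤q))

  geometric-superRecurrent : 0ℚ ≤ℚ c → 0ℚ ≤ℚ q → q ^ℚ 3 +ℚ q ^ℚ 2 +ℚ 1ℚ ≤ℚ q ^ℚ 4 →
                             SuperRecurrent (λ i → c *ℚ q ^ℚ i)
  geometric-superRecurrent 0≤c 0≤q ≤q⁴ i = begin
    c *ℚ q ^ℚ (3 + i) +ℚ c *ℚ q ^ℚ (2 + i) +ℚ c *ℚ q ^ℚ i ≡⟨ geometric-sum i ⟩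
    (c *ℚ q ^ℚ i) *ℚ (q ^ℚ 3 +ℚ q ^ℚ 2 +ℚ 1ℚ)           ≤⟨ ℚ.*-monoˡ-≤-nonNeg (c *ℚ q ^ℚ i) {{0≤cqⁱ}} ≤q⁴ ⟩
    (c *ℚ q ^ℚ i) *ℚ q ^ℚ 4                             ≡⟨ geometric-split i ⟨
    c *ℚ q ^ℚ (4 + i)                                   ∎
    where
    open ℚ.≤-Reasoning
    0≤cqⁱ = nonNegative (nonNeg-* 0≤c (^-nonNeg i 0≤q))

fromℕ : ℕ → ℚ
fromℕ k = + k / 1

fromℕ-+ : ∀ a b → fromℕ (a + b) ≡ fromℕ a +ℚ fromℕ b
fromℕ-+ a b = sym (trans (cong₂ _+ℚ_ (fromℕ≡mkℚ a) (fromℕ≡mkℚ b))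
  (ℚ./-cong (trans (cong₂ ℤ._+_ (ℤ.*-identityʳ (+ a)) (ℤ.*-identityʳ (+ b))) (sym (ℤ.pos-+ a b))) refl))
  where
  fromℕ≡mkℚ : ∀ k → fromℕ k ≡ mkℚ (+ k) 0 (Coprime.sym (Coprime.1-coprimeTo k))
  fromℕ≡mkℚ k = ℚ.normalize-coprime (Coprime.sym (Coprime.1-coprimeTo k))

module _ (f : ℕ → ℕ) (rec : ∀ i → f (4 + i) ≡ f (3 + i) + f (2 + i) + f i) where

  fromℕ-rec : ∀ i → fromℕ (f (4 + i)) ≡ fromℕ (f (3 + i)) +ℚ fromℕ (f (2 + i)) +ℚ fromℕ (f i)
  fromℕ-rec i = trans (cong fromℕ (rec i))
    (trans (fromℕ-+ (f (3 + i) + f (2 + i)) (f i))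
           (cong (_+ℚ fromℕ (f i)) (fromℕ-+ (f (3 + i)) (f (2 + i)))))

  fromℕ-subRecurrent : SubRecurrent (λ i → fromℕ (f i))
  fromℕ-subRecurrent i = ℚ.≤-reflexive (fromℕ-rec i)

  fromℕ-superRecurrent : SuperRecurrent (λ i → fromℕ (f i))
  fromℕ-superRecurrent i = ℚ.≤-reflexive (sym (fromℕ-rec i))

polyP-split : ∀ q → polyP q +ℚ (q ^ℚ 3 +ℚ q ^ℚ 2 +ℚ 1ℚ) ≡ q ^ℚ 4
polyP-split = solve 1 (λ q → q :^ 4 :- q :^ 3 :- q :^ 2 :- con 1ℚ :+ (q :^ 3 :+ q :^ 2 :+ con 1ℚ) := q :^ 4) refl
  where open ℚ-Solver

-- The Taylor expansion at 2, all of whose coefficients are positive.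
polyP-at-2 : ∀ q → let d = q -ℚ fromℕ 2 in
             polyP q ≡ fromℕ 3 +ℚ d *ℚ (fromℕ 16 +ℚ d *ℚ (fromℕ 17 +ℚ d *ℚ (fromℕ 7 +ℚ d)))
polyP-at-2 = solve 1 (λ q → let d = q :- con (fromℕ 2) in
                       q :^ 4 :- q :^ 3 :- q :^ 2 :- con 1ℚ
                       := con (fromℕ 3) :+ d :* (con (fromℕ 16) :+ d :* (con (fromℕ 17) :+ d :* (con (fromℕ 7) :+ d))))
                     refl
  where open ℚ-Solver

polyP-below-1 : ∀ q → polyP q +ℚ (1ℚ +ℚ q *ℚ q +ℚ q *ℚ (q *ℚ (q *ℚ (1ℚ -ℚ q)))) ≡ 0ℚ
polyP-below-1 = solve 1 (λ q → q :^ 4 :- q :^ 3 :- q :^ 2 :- con 1ℚ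
                                 :+ (con 1ℚ :+ q :* q :+ q :* (q :* (q :* (con 1ℚ :- q)))) := con 0ℚ) refl
  where open ℚ-Solver

polyP<0⇒q⁴≤ : ∀ q → polyP q < 0ℚ → q ^ℚ 4 ≤ℚ q ^ℚ 3 +ℚ q ^ℚ 2 +ℚ 1ℚ
polyP<0⇒q⁴≤ q p<0 = ℚ.<⇒≤ (subst₂ _<_ (polyP-split q) (ℚ.+-identityˡ _) (ℚ.+-monoˡ-< _ p<0))

0<polyP⇒≤q⁴ : ∀ q → 0ℚ < polyP q → q ^ℚ 3 +ℚ q ^ℚ 2 +ℚ 1ℚ ≤ℚ q ^ℚ 4
0<polyP⇒≤q⁴ q 0<p = ℚ.<⇒≤ (subst₂ _<_ (ℚ.+-identityˡ _) (polyP-split q) (ℚ.+-monoˡ-< _ 0<p))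

polyP<0⇒q≤2 : ∀ q → polyP q < 0ℚ → q ≤ℚ fromℕ 2
polyP<0⇒q≤2 q p<0 with q ≤? fromℕ 2
... | yes q≤2 = q≤2
... | no q≰2 = contradiction (subst (0ℚ <_) (sym (polyP-at-2 q)) 0<expansion) (ℚ.<-asym p<0)
  where
  d = q -ℚ fromℕ 2
  0≤d : 0ℚ ≤ℚ d
  0≤d = p≤q⇒0≤q-p (ℚ.<⇒≤ (ℚ.≰⇒> q≰2))
  0<expansion : 0ℚ < fromℕ 3 +ℚ d *ℚ (fromℕ 16 +ℚ d *ℚ (fromℕ 17 +ℚ d *ℚ (fromℕ 7 +ℚ d)))
  0<expansion = ℚ.+-mono-<-≤ (from-yes (0ℚ <? fromℕ 3))
    (nonNeg-* 0≤d (ℚ.+-mono-≤ (from-yes (0ℚ ≤? fromℕ 16))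
      (nonNeg-* 0≤d (ℚ.+-mono-≤ (from-yes (0ℚ ≤? fromℕ 17))
        (nonNeg-* 0≤d (ℚ.+-mono-≤ (from-yes (0ℚ ≤? fromℕ 7)) 0≤d))))))

0<polyP⇒1≤q : ∀ q → 0ℚ < q → 0ℚ < polyP q → 1ℚ ≤ℚ q
0<polyP⇒1≤q q 0<q 0<p with 1ℚ ≤? q
... | yes 1≤q = 1≤q
... | no 1≰q = contradiction (ℚ.+-mono-<-≤ 0<p 0≤rest) (ℚ.<-irrefl (sym (polyP-below-1 q)))
  where
  0≤q = ℚ.<⇒≤ 0<q
  0≤rest : 0ℚ ≤ℚ 1ℚ +ℚ q *ℚ q +ℚ q *ℚ (q *ℚ (q *ℚ (1ℚ -ℚ q)))
  0≤rest = ℚ.+-mono-≤ (ℚ.+-mono-≤ 0≤1ℚ (nonNeg-* 0≤q 0≤q))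
                      (nonNeg-* 0≤q (nonNeg-* 0≤q (nonNeg-* 0≤q (p≤q⇒0≤q-p (ℚ.<⇒≤ (ℚ.≰⇒> 1≰q))))))

-- The initial values of accepted boundary are 1, 1, 2, 4: they lie between c₁ 2ʲ⁺¹ and c₂.
c₁ c₂ : ℚ
c₁ = + 1 / 8
c₂ = fromℕ 4

accepted-lower : ∀ q → 0ℚ < q → polyP q < 0ℚ → ∀ i → c₁ *ℚ q ^ℚ suc i ≤ℚ fromℕ (accepted boundary i)
accepted-lower q 0<q p<0 =
  recurrence-comparison
    (SubRecurrent-shift {λ i → c₁ *ℚ q ^ℚ i} (geometric-subRecurrent c₁ q 0≤c₁ 0≤q (polyP<0⇒q⁴≤ q p<0)))
    (fromℕ-superRecurrent (accepted boundary) accepted-boundary-rec)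
    (initial 0) (initial 1) (initial 2) (initial 3)
  where
  0≤c₁ = from-yes (0ℚ ≤? c₁)
  0≤q = ℚ.<⇒≤ 0<q
  initial : ∀ j {_ : True (c₁ *ℚ fromℕ 2 ^ℚ suc j ≤? fromℕ (accepted boundary j))} →
            c₁ *ℚ q ^ℚ suc j ≤ℚ fromℕ (accepted boundary j)
  initial j {at-2} =
    ℚ.≤-trans (ℚ.*-monoˡ-≤-nonNeg c₁ {{nonNegative 0≤c₁}} (^-monoˡ-≤ (suc j) 0≤q (polyP<0⇒q≤2 q p<0)))
              (toWitness at-2)

accepted-upper : ∀ q → 0ℚ < q → 0ℚ < polyP q → ∀ i → fromℕ (accepted boundary i) ≤ℚ c₂ *ℚ q ^ℚ suc i
accepted-upper q 0<q 0<p =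
  recurrence-comparison
    (fromℕ-subRecurrent (accepted boundary) accepted-boundary-rec)
    (SuperRecurrent-shift {λ i → c₂ *ℚ q ^ℚ i}
      (geometric-superRecurrent c₂ q 0≤c₂ (ℚ.<⇒≤ 0<q) (0<polyP⇒≤q⁴ q 0<p)))
    (initial 0) (initial 1) (initial 2) (initial 3)
  where
  0≤c₂ = from-yes (0ℚ ≤? c₂)
  initial : ∀ j {_ : True (fromℕ (accepted boundary j) ≤? c₂)} →
            fromℕ (accepted boundary j) ≤ℚ c₂ *ℚ q ^ℚ suc j
  initial j {≤c₂} = begin
    fromℕ (accepted boundary j)  ≤⟨ toWitness ≤c₂ ⟩
    c₂                           ≡⟨ ℚ.*-identityʳ c₂ ⟨
    c₂ *ℚ 1ℚ
      ≤⟨ ℚ.*-monoˡ-≤-nonNeg c₂ {{nonNegative 0≤c₂}} (1≤^ (suc j) (0<polyP⇒1≤q q 0<q 0<p)) ⟩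
    c₂ *ℚ q ^ℚ suc j             ∎
    where open ℚ.≤-Reasoning

proposition8p3 :
    ((n : ℕ) → 3 ≤ n → SpectrumIs 𝔸G-mul n (cardR (n ∸ 1)))
    × Σ ℚ (λ c₁ → Σ ℚ (λ c₂ → 0ℚ < c₁ × 0ℚ < c₂ ×
        ((n : ℕ) → 3 ≤ n → (k : ℕ) → SpectrumIs 𝔸G-mul n k →
          ((q : ℚ) → 0ℚ < q → polyP q < 0ℚ → c₁ *ℚ (q ^ℚ n) ≤ℚ (+ k / 1))
          × ((q : ℚ) → 0ℚ < q → 0ℚ < polyP q → (+ k / 1) ≤ℚ c₂ *ℚ (q ^ℚ n)))))
proposition8p3 = spectrum , c₁ , c₂ , from-yes (0ℚ <? c₁) , from-yes (0ℚ <? c₂) , growth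
  where
  spectrum : (n : ℕ) → 3 ≤ n → SpectrumIs 𝔸G-mul n (cardR (n ∸ 1))
  spectrum (suc (suc (suc k))) (s≤s (s≤s (s≤s _))) = spectrumIs-cardR k

  growth : (n : ℕ) → 3 ≤ n → (k : ℕ) → SpectrumIs 𝔸G-mul n k →
           ((q : ℚ) → 0ℚ < q → polyP q < 0ℚ → c₁ *ℚ (q ^ℚ n) ≤ℚ (+ k / 1))
           × ((q : ℚ) → 0ℚ < q → 0ℚ < polyP q → (+ k / 1) ≤ℚ c₂ *ℚ (q ^ℚ n))
  growth n@(suc i@(suc (suc j))) 3≤n@(s≤s (s≤s (s≤s _))) k sₙ≡k
    with refl ← trans (spectrumIs-functional _·_ sₙ≡k (spectrum n 3≤n)) (cardR≡accepted j) =
    (λ q 0<q p<0 → accepted-lower q 0<q p<0 i) , (λ q 0<q 0<p → accepted-upper q 0<q 0<p i)
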